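{- There is no irregular multi-orientable three-dimensional GFT graph in which some face is broken by one single external edge only (that is, some face whose boundary passes through exactly one external leg).
   Context: A three-dimensional (orientable) GFT graph is a graph with 4-valent vertices in which every edge consists of three parallel strands (left, middle, right), joined without twists. At each vertex the four half-edges are cyclically ordered, and strands are joined inside the vertex following the Boulatov vertex $\phi(g_1,g_2,g_3)\phi(g_3,g_4,g_5)\phi(g_5,g_2,g_6)\phi(g_6,g_4,g_1)$: each pair of distinct half-edges at a vertex shares exactly one strand; the middle strand of a half-edge connects to the cyclically opposite half-edge and the two outer strands connect to the two cyclically adjacent half-edges. The graph may have external legs (unpaired half-edges). Deleting the middle strands yields a ribbon graph (the jacket); its faces are the maximal strand paths, closed or ending at external legs. A face is broken by an external leg if it passes through that leg; $B$ denotes the number of faces broken by external legs, and the graph is irregular if $B>1$. A GFT graph is multi-orientable if each half-edge can be labeled $+$ or $-$ so that at every vertex there are two $+$ and two $-$ half-edges alternating in the cyclic order ($+,-,+,-$), and every (internal) edge joins a $-$ half-edge to a $+$ half-edge. -}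

module Defs where

open import Data.Nat using (ℕ)
open import Data.Fin using (Fin; zero; suc)
open import Data.Maybe using (Maybe; just; nothing)
open import Data.Bool using (Bool)
open import Data.Product using (_×_; _,_; proj₁; proj₂; Σ; ∃; ∃-syntax)
open import Relation.Binary.PropositionalEquality using (_≡_; _≢_)
open import Relation.Nullary using (¬_)

next : Fin 4 → Fin 4
next zero = suc zero
next (suc zero) = suc (suc zero)
next (suc (suc zero)) = suc (suc (suc zero))
next (suc (suc (suc zero))) = zero

prev : Fin 4 → Fin 4
prev zero = suc (suc (suc zero))
prev (suc zero) = zero
prev (suc (suc zero)) = suc zero
prev (suc (suc (suc zero))) = suc (suc zero)

opp : Fin 4 → Fin 4
opp i = next (next i)

-- The three strands of a half-edge.
data Side : Set where
  left middle right : Side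

-- Edges are joined without twists: the left strand seen from one end is the
-- right strand seen from the other end; the middle strand stays middle.
flip : Side → Side
flip left = right
flip middle = middle
flip right = left

-- A (3D) GFT graph with 4-valent vertices 0..n-1; half-edge (v , i) is the
-- i-th half-edge at v in the cyclic order.  `pair h = just h'` means h and h'
-- form an internal edge; `pair h = nothing` means h is an external leg.
record GFTGraph : Set where
  field
    n : ℕ
    pair : Fin n × Fin 4 → Maybe (Fin n × Fin 4)
    pair-sym : ∀ h h' → pair h ≡ just h' → pair h' ≡ just h
    pair-irrefl : ∀ h → pair h ≢ just h

module _ (G : GFTGraph) where
  open GFTGraph G

  HalfEdge : Set
  HalfEdge = Fin n × Fin 4

  StrandEnd : Set
  StrandEnd = HalfEdge × Side

  External : HalfEdge → Set
  External h = pair h ≡ nothing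

  -- Strand connections inside a vertex (Boulatov vertex):
  -- right of i ↔ left of next i, middle of i ↔ middle of opposite half-edge.
  inner : StrandEnd → StrandEnd
  inner ((v , i) , left) = (v , prev i) , right
  inner ((v , i) , middle) = (v , opp i) , middle
  inner ((v , i) , right) = (v , next i) , left

  -- Trail x y : following the strand that enters a vertex at strand end x,
  -- alternately through vertices and internal edges, one arrives at the
  -- external leg strand end y.  (A maximal open strand path.)
  data Trail : StrandEnd → StrandEnd → Set where
    stop : ∀ {x} → External (proj₁ (inner x)) → Trail x (inner x)
    go : ∀ {x h' y} → pair (proj₁ (inner x)) ≡ just h' →
         Trail (h' , flip (proj₂ (inner x))) y → Trail x y

  -- x and y are the two ends of a face broken by external legs.
  BrokenFace : StrandEnd → StrandEnd → Set
  BrokenFace x y = External (proj₁ x) × Trail x y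

  -- B > 1: there are at least two distinct faces broken by external legs
  -- (a broken face is determined by its end points).
  Irregular : Set
  Irregular = ∃[ x ] ∃[ y ] ∃[ x' ] ∃[ y' ]
    (BrokenFace x y × BrokenFace x' y' × x' ≢ x × x' ≢ y)

  -- Some face passes through exactly one external leg (both its ends lie on
  -- the same external leg).
  SingleLegFace : Set
  SingleLegFace = ∃[ x ] ∃[ y ] (BrokenFace x y × proj₁ x ≡ proj₁ y)

  -- Multi-orientability: a ± labelling of all half-edges (legs included),
  -- alternating around every vertex, each internal edge joining + to −.
  MultiOrientable : Set
  MultiOrientable = Σ (HalfEdge → Bool) λ sign →
    (∀ v i → sign (v , i) ≢ sign (v , next i)) ×
    (∀ h h' → pair h ≡ just h' → sign h ≢ sign h')

module Submission where

-- A face broken by a single external leg would be a strand path that leaves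
-- and re-enters the graph through the same leg.  We rule this out in a
-- multi-orientable graph by distinguishing the strand it starts on.
--
-- * Outer strands.  Inside a vertex an outer strand passes to a cyclically
--   adjacent half-edge, and along an internal edge it passes to the partner
--   half-edge; both moves reverse the ± label.  A path from leg to leg makes
--   one more vertex move than edge moves, so its two ends carry opposite
--   labels and cannot lie on the same leg.
-- * Middle strands.  A middle strand stays middle, so it would end on the
--   very strand end it started from.  Such a path is its own reverse; peeling
--   off its first and last steps simultaneously shrinks it to its midpoint,
--   which would be a fixed point of the vertex involution ('inner') or of
--   the edge involution ('pair') — and neither has one.

open import Defs
open import Relation.Nullary using (¬_)
open import Data.Nat using (ℕ; zero; suc)
open import Data.Fin using (zero; suc)
open import Data.Maybe using (just)
open import Data.Maybe.Properties using (just-injective)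
open import Data.Bool using (Bool; not)
open import Data.Bool.Properties using (not-involutive; ¬-not; not-¬)
open import Data.Product using (_×_; _,_; proj₁; proj₂; ∃-syntax)
open import Relation.Binary.PropositionalEquality

next-prev : ∀ i → next (prev i) ≡ i
next-prev zero = refl
next-prev (suc zero) = refl
next-prev (suc (suc zero)) = refl
next-prev (suc (suc (suc zero))) = refl

prev-next : ∀ i → prev (next i) ≡ i
prev-next zero = refl
prev-next (suc zero) = refl
prev-next (suc (suc zero)) = refl
prev-next (suc (suc (suc zero))) = refl

opp-involutive : ∀ i → opp (opp i) ≡ i
opp-involutive zero = refl
opp-involutive (suc zero) = refl
opp-involutive (suc (suc zero)) = refl
opp-involutive (suc (suc (suc zero))) = refl

opp-fixpoint-free : ∀ i → opp i ≢ i
opp-fixpoint-free zero ()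
opp-fixpoint-free (suc zero) ()
opp-fixpoint-free (suc (suc zero)) ()
opp-fixpoint-free (suc (suc (suc zero))) ()

flip-involutive : ∀ s → flip (flip s) ≡ s
flip-involutive left = refl
flip-involutive middle = refl
flip-involutive right = refl

data Outer : Side → Set where
  left-outer  : Outer left
  right-outer : Outer right

flip-outer : ∀ {s} → Outer s → Outer (flip s)
flip-outer left-outer = right-outer
flip-outer right-outer = left-outer

module _ (G : GFTGraph) where
  open GFTGraph G

  inner-involutive : ∀ x → inner G (inner G x) ≡ x
  inner-involutive ((v , i) , left) = cong (λ j → (v , j) , left) (next-prev i)
  inner-involutive ((v , i) , middle) = cong (λ j → (v , j) , middle) (opp-involutive i)
  inner-involutive ((v , i) , right) = cong (λ j → (v , j) , right) (prev-next i)

  inner-fixpoint-free : ∀ x → inner G x ≢ x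
  inner-fixpoint-free ((v , i) , left) ()
  inner-fixpoint-free ((v , i) , middle) eq =
    opp-fixpoint-free i (cong (λ z → proj₂ (proj₁ z)) eq)
  inner-fixpoint-free ((v , i) , right) ()

  data Step : StrandEnd G → StrandEnd G → Set where
    cross : ∀ {x h'} → pair (proj₁ (inner G x)) ≡ just h' →
            Step x (h' , flip (proj₂ (inner G x)))

  step-deterministic : ∀ {x y y'} → Step x y → Step x y' → y ≡ y'
  step-deterministic (cross p) (cross p')
    rewrite just-injective (trans (sym p) p') = refl

  step-reverse : ∀ {x y} → Step x y → Step (inner G y) (inner G x)
  step-reverse {x} (cross {h' = h'} p) = subst (Step (inner G y)) back (cross across)
    where
    y : StrandEnd G
    y = h' , flip (proj₂ (inner G x))
    across : pair (proj₁ (inner G (inner G y))) ≡ just (proj₁ (inner G x))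
    across rewrite inner-involutive y = pair-sym _ _ p
    back : (proj₁ (inner G x) , flip (proj₂ (inner G (inner G y)))) ≡ inner G x
    back rewrite inner-involutive y = cong (proj₁ (inner G x) ,_) (flip-involutive _)

  -- A step crosses an edge, so it never ends where crossing the vertex
  -- alone would have led: edges join two distinct half-edges.
  step-leaves-vertex : ∀ {x y} → Step x y → inner G x ≢ y
  step-leaves-vertex (cross p) eq =
    pair-irrefl _ (trans p (cong just (sym (cong proj₁ eq))))

  data Walk : ℕ → StrandEnd G → StrandEnd G → Set where
    []  : ∀ {x} → Walk zero x x
    _∷_ : ∀ {k x y z} → Step x y → Walk k y z → Walk (suc k) x z

  unsnoc : ∀ {k x z} → Walk (suc k) x z → ∃[ y ] (Walk k x y × Step y z)
  unsnoc (s ∷ []) = _ , [] , s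
  unsnoc (s ∷ w@(_ ∷ _)) with unsnoc w
  ... | y , w' , t = y , s ∷ w' , t

  -- Comparing the first step
  -- with the reverse of the last step shows that the walk strictly between
  -- them has the same property, so we shrink the walk to length 0 or 1, where 'inner' or the
  -- edge would have a fixed point.
  walk-not-self-reverse : ∀ k {x z} → Walk k x z → inner G z ≢ x
  walk-not-self-reverse zero [] = inner-fixpoint-free _
  walk-not-self-reverse (suc zero) (s ∷ []) refl =
    step-leaves-vertex s (inner-involutive _)
  walk-not-self-reverse (suc (suc k)) (s ∷ w) refl with unsnoc w
  ... | y , w' , t =
    walk-not-self-reverse k w' (sym (step-deterministic s (step-reverse t)))

  trail-walk : ∀ {x y} → Trail G x y → ∃[ k ] ∃[ z ] (Walk k x z × inner G z ≡ y)
  trail-walk (stop _) = zero , _ , [] , refl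
  trail-walk (go p t) with trail-walk t
  ... | k , z , w , eq = suc k , z , cross p ∷ w , eq

  trail-middle : ∀ {h y} → Trail G (h , middle) y → proj₂ y ≡ middle
  trail-middle (stop _) = refl
  trail-middle (go _ t) = trail-middle t

  -- A face running along middle strands cannot leave and enter through the
  -- same leg: it would end on its own starting strand end.
  middle-trail-not-closed : ∀ {h h' s} → Trail G (h , middle) (h' , s) → h ≢ h'
  middle-trail-not-closed t refl with trail-middle t
  ... | refl with trail-walk t
  ...   | k , z , w , eq = walk-not-self-reverse k w eq

  module Signs (sign : HalfEdge G → Bool)
               (alternating : ∀ v i → sign (v , i) ≢ sign (v , next i))
               (edge-opposite : ∀ h h' → pair h ≡ just h' → sign h ≢ sign h') where

    -- Inside a vertex an outer strand moves to an adjacent half-edge, so it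
    -- reverses the sign and stays outer.
    inner-outer : ∀ {h s} → Outer s →
                  sign (proj₁ (inner G (h , s))) ≡ not (sign h) × Outer (proj₂ (inner G (h , s)))
    inner-outer {v , i} left-outer =
      ¬-not (λ eq → alternating v (prev i) (trans eq (cong (λ j → sign (v , j)) (sym (next-prev i))))) ,
      right-outer
    inner-outer {v , i} right-outer = ¬-not (≢-sym (alternating v i)) , left-outer

    -- Along a trail starting on an outer strand the sign is reversed: each
    -- 'go' reverses it twice (vertex, then edge), the final 'stop' once.
    trail-sign : ∀ {h s y} → Trail G (h , s) y → Outer s → sign (proj₁ y) ≡ not (sign h)
    trail-sign (stop _) o = proj₁ (inner-outer o)
    trail-sign {h} {s} {y} (go {h' = h'} p t) o with inner-outer {h} o
    ... | vertex-flip , o' = begin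
      sign (proj₁ y)                             ≡⟨ trail-sign t (flip-outer o') ⟩
      not (sign h')                              ≡⟨ cong not (¬-not (≢-sym (edge-opposite _ _ p))) ⟩
      not (not (sign (proj₁ (inner G (h , s))))) ≡⟨ cong (λ b → not (not b)) vertex-flip ⟩
      not (not (not (sign h)))                   ≡⟨ not-involutive _ ⟩
      not (sign h)                               ∎
      where open ≡-Reasoning

    outer-trail-not-closed : ∀ {h h' s s'} → Trail G (h , s) (h' , s') → Outer s → h ≢ h'
    outer-trail-not-closed t o refl = not-¬ refl (trail-sign t o)

lemma3p1 : (G : GFTGraph) → MultiOrientable G → Irregular G → ¬ SingleLegFace G
lemma3p1 G (sign , alternating , edge-opposite) _ ((h , s) , (h' , _) , (_ , t) , same-leg) =
  by-strand s t same-leg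
  where
  open Signs G sign alternating edge-opposite
  by-strand : ∀ s {s'} → Trail G (h , s) (h' , s') → h ≢ h'
  by-strand left t = outer-trail-not-closed t left-outer
  by-strand middle t = middle-trail-not-closed G t
  by-strand right t = outer-trail-not-closed t right-outer
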